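{- Let $(H_{2n-1})_{n\geq1}$ be the median Genocchi numbers and let $Ls(m,j)$, $LS(n,j)$ be the Legendre–Stirling numbers of the first and second kind. Then for all integers $m\geq0$ and $n\geq1$, \[ \sum_{j=0}^{m}(-1)^{m+j}Ls(m,j)H_{2n+2j-1}=m!\sum_{j=0}^n(-1)^{n+j}LS(n,j)\,j!\,(j+m)!. \]
   Context: Seidel triangle: numbers $g_{n,j}$ for $j\geq1$, $1\leq n\leq (j+1)/2$ (zero outside this range), with $g_{1,1}=1$, $g_{n,2j}=\sum_{q\geq n}g_{q,2j-1}$, $g_{n,2j+1}=\sum_{q\leq n}g_{q,2j}$; the median Genocchi numbers are $H_{2n-1}=g_{1,2n}$. Stirling type numbers for a sequence $(a_n)_{n\geq1}$: $t(n+1,j)=t(n,j-1)-a_nt(n,j)$ and $T(n+1,j)=T(n,j-1)+a_jT(n,j)$, with $t(n,0)=T(n,0)=\delta_{n,0}$ and $t(n,j)=T(n,j)=0$ for $n<j$. The Legendre–Stirling numbers $Ls(n,j)$, $LS(n,j)$ are $t(n,j)$, $T(n,j)$ for $a_n=n(n+1)$. -}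

module Defs where

open import Data.Nat as ℕ using (ℕ; zero; suc; _≤ᵇ_)
open import Data.Nat using (_!)
open import Data.Integer using (ℤ; +_; _+_; _-_; _*_; -_)
open import Data.Bool using (Bool; true; false; if_then_else_; _∧_)

sumFrom : ℕ → ℕ → (ℕ → ℤ) → ℤ
sumFrom a zero    f = + 0
sumFrom a (suc k) f = f a + sumFrom (suc a) k f

sum0 : ℕ → (ℕ → ℤ) → ℤ
sum0 n f = sumFrom 0 (suc n) f

sgn : ℕ → ℤ
sgn zero    = + 1
sgn (suc k) = - sgn k

even : ℕ → Bool
even zero = true
even (suc k) with even k
... | true = false
... | false = true

inRange : ℕ → ℕ → Bool
inRange n j = (1 ≤ᵇ n) ∧ (2 ℕ.* n ≤ᵇ suc j)

-- Seidel triangle  seidel n j = g_{n,j}  (zero outside 1 ≤ n ≤ (j+1)/2, and for j = 0).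
-- g_{1,1} = 1; g_{n,2j} = Σ_{q ≥ n} g_{q,2j-1}; g_{n,2j+1} = Σ_{q ≤ n} g_{q,2j}.
-- In column j (j ≥ 1) all nonzero entries have row ≤ j, so the infinite sums are
-- truncated at row j (resp. rows 1..n) without loss.
seidel : ℕ → ℕ → ℤ
seidel n zero = + 0
seidel n (suc zero) = if (n ℕ.≡ᵇ 1) then + 1 else + 0
seidel n (suc (suc j)) =
  if inRange n (suc (suc j))
  then (if even (suc (suc j))
        then sumFrom n (suc j) (λ q → seidel q (suc j))   -- rows n .. n+j ⊇ rows n..(j+1)
        else sumFrom 1 n (λ q → seidel q (suc j)))
  else + 0

-- median Genocchi numbers: H (2n-1) = g_{1,2n}; we write medianGenocchi n = H_{2n-1} for n ≥ 1
medianGenocchi : ℕ → ℤ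
medianGenocchi n = seidel 1 (2 ℕ.* n)

-- Stirling type numbers of a sequence a (a n = a_n for n ≥ 1)
-- t(n+1,j) = t(n,j-1) - a_n t(n,j),  t(n,0) = δ_{n,0}
stirT1 : (ℕ → ℤ) → ℕ → ℕ → ℤ
stirT1 a zero    zero    = + 1
stirT1 a zero    (suc j) = + 0
stirT1 a (suc n) zero    = + 0
stirT1 a (suc n) (suc j) = stirT1 a n j - a n * stirT1 a n (suc j)

stirT2 : (ℕ → ℤ) → ℕ → ℕ → ℤ
stirT2 a zero    zero    = + 1
stirT2 a zero    (suc j) = + 0
stirT2 a (suc n) zero    = + 0
stirT2 a (suc n) (suc j) = stirT2 a n j + a (suc j) * stirT2 a n (suc j)

legendreSeq : ℕ → ℤ
legendreSeq n = + (n ℕ.* suc n)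

Ls : ℕ → ℕ → ℤ
Ls = stirT1 legendreSeq

LS : ℕ → ℕ → ℤ
LS = stirT2 legendreSeq

fact : ℕ → ℤ
fact n = + (n !)

-- Regard both sides as tables F(m, n), the theorem being the entry at n + 1. Both
-- satisfy F(m+1, n) = F(m, n+1) + m(m+1) F(m, n): the left side by the recurrence of
-- Ls, the right side by the recurrence of LS together with
-- (m+1) j! (j+m+1)! = (j+1)! (j+m+1)! + (m(m+1) - j(j+1)) j! (j+m)!.
-- So they agree once they agree at n = 0, where the claim reads
-- Σ_j (-1)^(m+j) Ls(m,j) H_{2j-1} = m!² with H_{-1} = 1.
-- For this, read the Seidel triangle as two tables V(s,t) = g_{s+1,2(s+t)} and
-- U(s+1,t) = g_{s+1,2(s+t)+1}. The Seidel rules become recurrences in (s, t) which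
-- show V(k,t) = Σ_j (-1)^(k+j) T(2k+2,2j+2) F(j,t), with F the left-hand table and T
-- the central factorial numbers. At t = 0 the entries V(k,0), k ≥ 1, lie outside the
-- triangle, so this transform of F(·,0) is δ_{k0}; so is its transform of j!², by
-- telescoping, and the matrix T(2k+2,2j+2) is unitriangular, hence F(j,0) = j!².

module Submission where

open import Defs
open import Data.Integer using (ℤ; _*_)
open import Relation.Binary.PropositionalEquality using (_≡_; trans)

module LegendreGenocchi where

  open import Data.Bool using (Bool; true; false; not; if_then_else_)
  open import Data.Bool.Properties using (not-involutive; T-≡)
  open import Data.Integer using (+_; -_; _+_; _-_)
  open import Data.Integer.Properties
    using (+-assoc; +-comm; +-identityˡ; +-identityʳ; *-identityˡ; *-assoc; *-zeroʳ; *-distribˡ-+; neg-distrib-+; neg-involutive; +-inverseʳ; pos-*; pos-+)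
  open import Data.Integer.Tactic.RingSolver using (solve-∀)
  open import Data.Nat.Base as ℕ using (ℕ; zero; suc; z≤n; s≤s; _≤_; _<_; _≤ᵇ_; _!)
  import Data.Nat.Properties as ℕₚ
  open import Data.Nat.Induction using (<-rec)
  open import Function using (_∘_; Equivalence)
  open import Relation.Nullary using (yes; no; contradiction)
  open import Relation.Nullary.Reflects using (ofʸ)
  open import Relation.Binary.PropositionalEquality using (refl; sym; trans; cong; cong₂; subst; module ≡-Reasoning)
  open ≡-Reasoning

  isolateˡ : ∀ {x y z : ℤ} → x ≡ y + z → y ≡ x - z
  isolateˡ {y = y} {z} refl = sym (cancel y z)
    where
    cancel : ∀ y z → y + z - z ≡ y
    cancel = solve-∀

  difference-zero : ∀ {x y : ℤ} → x - y ≡ + 0 → x ≡ y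
  difference-zero {x} {y} x-y≡0 = begin
    x          ≡⟨ regroup x y ⟩
    x - y + y  ≡⟨ cong (_+ y) x-y≡0 ⟩
    + 0 + y    ≡⟨ +-identityˡ y ⟩
    y          ∎
    where
    regroup : ∀ x y → x ≡ x - y + y
    regroup = solve-∀

  sumFrom-cong : ∀ a k {f g : ℕ → ℤ} → (∀ i → f i ≡ g i) → sumFrom a k f ≡ sumFrom a k g
  sumFrom-cong a zero    f≗g = refl
  sumFrom-cong a (suc k) f≗g = cong₂ _+_ (f≗g a) (sumFrom-cong (suc a) k f≗g)

  sumFrom-shift : ∀ a k (f : ℕ → ℤ) → sumFrom (suc a) k f ≡ sumFrom a k (f ∘ suc)
  sumFrom-shift a zero    f = refl
  sumFrom-shift a (suc k) f = cong (_+_ (f (suc a))) (sumFrom-shift (suc a) k f)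

  sumFrom-+ : ∀ a k (f g : ℕ → ℤ) → sumFrom a k (λ i → f i + g i) ≡ sumFrom a k f + sumFrom a k g
  sumFrom-+ a zero    f g = refl
  sumFrom-+ a (suc k) f g = begin
    f a + g a + sumFrom (suc a) k (λ i → f i + g i)          ≡⟨ cong (_+_ (f a + g a)) (sumFrom-+ (suc a) k f g) ⟩
    f a + g a + (sumFrom (suc a) k f + sumFrom (suc a) k g)  ≡⟨ interchange (f a) (g a) _ _ ⟩
    f a + sumFrom (suc a) k f + (g a + sumFrom (suc a) k g)  ∎
    where
    interchange : ∀ x y u v → x + y + (u + v) ≡ x + u + (y + v)
    interchange = solve-∀

  *-sumFrom : ∀ a k c (f : ℕ → ℤ) → c * sumFrom a k f ≡ sumFrom a k (λ i → c * f i)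
  *-sumFrom a zero    c f = *-zeroʳ c
  *-sumFrom a (suc k) c f = trans (*-distribˡ-+ c (f a) _) (cong (_+_ (c * f a)) (*-sumFrom (suc a) k c f))

  neg-sumFrom : ∀ a k (f : ℕ → ℤ) → - sumFrom a k f ≡ sumFrom a k (λ i → - f i)
  neg-sumFrom a zero    f = refl
  neg-sumFrom a (suc k) f = trans (neg-distrib-+ (f a) _) (cong (_+_ (- f a)) (neg-sumFrom (suc a) k f))

  sumFrom-suc : ∀ a k (f : ℕ → ℤ) → sumFrom a (suc k) f ≡ sumFrom a k f + f (a ℕ.+ k)
  sumFrom-suc a zero    f = begin
    f a + + 0      ≡⟨ +-identityʳ (f a) ⟩
    f a            ≡⟨ cong f (sym (ℕₚ.+-identityʳ a)) ⟩
    f (a ℕ.+ 0)    ≡⟨ sym (+-identityˡ _) ⟩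
    + 0 + f (a ℕ.+ 0) ∎
  sumFrom-suc a (suc k) f = begin
    f a + sumFrom (suc a) (suc k) f                ≡⟨ cong (_+_ (f a)) (sumFrom-suc (suc a) k f) ⟩
    f a + (sumFrom (suc a) k f + f (suc a ℕ.+ k))  ≡⟨ sym (+-assoc (f a) _ _) ⟩
    f a + sumFrom (suc a) k f + f (suc a ℕ.+ k)    ≡⟨ cong (λ i → f a + sumFrom (suc a) k f + f i) (sym (ℕₚ.+-suc a k)) ⟩
    f a + sumFrom (suc a) k f + f (a ℕ.+ suc k)    ∎

  sumFrom-zero : ∀ a k (f : ℕ → ℤ) → (∀ i → a ≤ i → i < a ℕ.+ k → f i ≡ + 0) → sumFrom a k f ≡ + 0
  sumFrom-zero a zero    f f≡0 = refl
  sumFrom-zero a (suc k) f f≡0 =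
    cong₂ _+_ (f≡0 a ℕₚ.≤-refl (ℕₚ.m<m+n a (s≤s z≤n))) (sumFrom-zero (suc a) k f inner)
    where
    inner : ∀ i → suc a ≤ i → i < suc a ℕ.+ k → f i ≡ + 0
    inner i a<i i<a+k = f≡0 i (ℕₚ.<⇒≤ a<i) (subst (i <_) (sym (ℕₚ.+-suc a k)) i<a+k)

  sum0-head : ∀ m (f : ℕ → ℤ) → f 0 ≡ + 0 → sum0 (suc m) f ≡ sum0 m (f ∘ suc)
  sum0-head m f f₀≡0 =
    trans (cong (_+ sumFrom 1 (suc m) f) f₀≡0) (trans (+-identityˡ _) (sumFrom-shift 0 (suc m) f))

  sum0-last : ∀ m (f : ℕ → ℤ) → f (suc m) ≡ + 0 → sum0 (suc m) f ≡ sum0 m f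
  sum0-last m f fₘ≡0 = trans (sumFrom-suc 0 (suc m) f) (trans (cong (_+_ (sum0 m f)) fₘ≡0) (+-identityʳ _))

  sum0-shift : ∀ m (f : ℕ → ℤ) → f 0 ≡ + 0 → f (suc m) ≡ + 0 → sum0 m (f ∘ suc) ≡ sum0 m f
  sum0-shift m f f₀≡0 fₘ≡0 = trans (sym (sum0-head m f f₀≡0)) (sum0-last m f fₘ≡0)

  sgn-+-suc : ∀ m j → sgn (m ℕ.+ suc j) ≡ - sgn (m ℕ.+ j)
  sgn-+-suc m j = cong sgn (ℕₚ.+-suc m j)

  sgn-suc-+-suc : ∀ m j → sgn (suc m ℕ.+ suc j) ≡ sgn (m ℕ.+ j)
  sgn-suc-+-suc m j = trans (cong -_ (sgn-+-suc m j)) (neg-involutive _)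

  sgn-+-self : ∀ k → sgn (k ℕ.+ k) ≡ + 1
  sgn-+-self zero    = refl
  sgn-+-self (suc k) = trans (sgn-suc-+-suc k k) (sgn-+-self k)

  fact-suc : ∀ n → fact (suc n) ≡ (+ 1 + + n) * fact n
  fact-suc n = pos-* (suc n) (n !)

  legendreSeq-≡ : ∀ n → legendreSeq n ≡ + n * (+ 1 + + n)
  legendreSeq-≡ n = pos-* n (suc n)

  delta₀ : ℕ → ℤ
  delta₀ zero    = + 1
  delta₀ (suc k) = + 0

  signedTerm : (ℕ → ℕ → ℤ) → (ℕ → ℤ) → ℕ → ℕ → ℤ
  signedTerm D g k j = sgn (k ℕ.+ j) * D k j * g j

  signedTransform : (ℕ → ℕ → ℤ) → (ℕ → ℤ) → ℕ → ℤ
  signedTransform D g k = sum0 k (signedTerm D g k)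

  signedTransform-zero : ∀ D (g : ℕ → ℤ) → D 0 0 ≡ + 1 → signedTransform D g 0 ≡ g 0
  signedTransform-zero D g D₀₀≡1 = begin
    + 1 * D 0 0 * g 0 + + 0  ≡⟨ +-identityʳ _ ⟩
    + 1 * D 0 0 * g 0        ≡⟨ cong (λ d → + 1 * d * g 0) D₀₀≡1 ⟩
    + 1 * + 1 * g 0          ≡⟨ *-identityˡ (g 0) ⟩
    g 0                      ∎

  module _ (D : ℕ → ℕ → ℤ) where

    signedTransform-cong : ∀ {g g′ : ℕ → ℤ} k → (∀ j → g j ≡ g′ j) →
                           signedTransform D g k ≡ signedTransform D g′ k
    signedTransform-cong k g≗g′ = sumFrom-cong 0 (suc k) (λ j → cong (sgn (k ℕ.+ j) * D k j *_) (g≗g′ j))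

    signedTransform-+ : ∀ (g g′ : ℕ → ℤ) k →
      signedTransform D (λ j → g j + g′ j) k ≡ signedTransform D g k + signedTransform D g′ k
    signedTransform-+ g g′ k =
      trans (sumFrom-cong 0 (suc k) (λ j → *-distribˡ-+ (sgn (k ℕ.+ j) * D k j) (g j) (g′ j)))
            (sumFrom-+ 0 (suc k) (signedTerm D g k) (signedTerm D g′ k))

    signedTransform-* : ∀ c (g : ℕ → ℤ) k →
      c * signedTransform D g k ≡ signedTransform D (λ j → c * g j) k
    signedTransform-* c g k =
      trans (*-sumFrom 0 (suc k) c _) (sumFrom-cong 0 (suc k) (λ j → commute c (sgn (k ℕ.+ j) * D k j) (g j)))
      where
      commute : ∀ c d x → c * (d * x) ≡ d * (c * x)
      commute = solve-∀

    signedTransform-- : ∀ (g g′ : ℕ → ℤ) k →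
      signedTransform D g k - signedTransform D g′ k ≡ signedTransform D (λ j → g j - g′ j) k
    signedTransform-- g g′ k = begin
      signedTransform D g k - signedTransform D g′ k
        ≡⟨ cong (_+_ (signedTransform D g k)) (neg-sumFrom 0 (suc k) (signedTerm D g′ k)) ⟩
      signedTransform D g k + sum0 k (λ j → - signedTerm D g′ k j)
        ≡⟨ sym (sumFrom-+ 0 (suc k) (signedTerm D g k) (λ j → - signedTerm D g′ k j)) ⟩
      sum0 k (λ j → signedTerm D g k j - signedTerm D g′ k j)
        ≡⟨ sumFrom-cong 0 (suc k) (λ j → factor (sgn (k ℕ.+ j) * D k j) (g j) (g′ j)) ⟩
      signedTransform D (λ j → g j - g′ j) k ∎
      where
      factor : ∀ d x y → d * x - d * y ≡ d * (x - y)
      factor = solve-∀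

    signedTransform-kernel : (∀ k → D k k ≡ + 1) → ∀ {g : ℕ → ℤ} →
                             (∀ k → signedTransform D g k ≡ + 0) → ∀ k → g k ≡ + 0
    signedTransform-kernel diagonal {g} Tg≡0 = <-rec _ step
      where
      step : ∀ k → (∀ {j} → j < k → g j ≡ + 0) → g k ≡ + 0
      step k below = begin
        g k                                         ≡⟨ sym (*-identityˡ (g k)) ⟩
        + 1 * + 1 * g k                             ≡⟨ cong₂ (λ s d → s * d * g k) (sym (sgn-+-self k)) (sym (diagonal k)) ⟩
        f k                                         ≡⟨ sym (+-identityˡ (f k)) ⟩
        + 0 + f k                                   ≡⟨ cong (_+ f k) (sym (sumFrom-zero 0 k f prefix)) ⟩
        sumFrom 0 k f + f k                         ≡⟨ sym (sumFrom-suc 0 k f) ⟩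
        signedTransform D g k                       ≡⟨ Tg≡0 k ⟩
        + 0                                         ∎
        where
        f : ℕ → ℤ
        f j = sgn (k ℕ.+ j) * D k j * g j
        prefix : ∀ j → 0 ≤ j → j < k → f j ≡ + 0
        prefix j _ j<k = trans (cong (sgn (k ℕ.+ j) * D k j *_) (below j<k)) (*-zeroʳ (sgn (k ℕ.+ j) * D k j))

    signedTransform-injective : (∀ k → D k k ≡ + 1) → ∀ {g g′ : ℕ → ℤ} →
      (∀ k → signedTransform D g k ≡ signedTransform D g′ k) → ∀ k → g k ≡ g′ k
    signedTransform-injective diagonal {g} {g′} Tg≡Tg′ k =
      difference-zero (signedTransform-kernel diagonal Tdiff≡0 k)
      where
      Tdiff≡0 : ∀ k → signedTransform D (λ j → g j - g′ j) k ≡ + 0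
      Tdiff≡0 k = begin
        signedTransform D (λ j → g j - g′ j) k          ≡⟨ sym (signedTransform-- g g′ k) ⟩
        signedTransform D g k - signedTransform D g′ k  ≡⟨ cong (_- signedTransform D g′ k) (Tg≡Tg′ k) ⟩
        signedTransform D g′ k - signedTransform D g′ k ≡⟨ +-inverseʳ (signedTransform D g′ k) ⟩
        + 0                                             ∎

  stirT1-above : ∀ (a : ℕ → ℤ) {m j} → m < j → stirT1 a m j ≡ + 0
  stirT1-above a {zero}  {suc j} _           = refl
  stirT1-above a {suc m} {suc j} (s≤s m<j) = begin
    stirT1 a m j - a m * stirT1 a m (suc j)
      ≡⟨ cong₂ (λ x y → x - a m * y) (stirT1-above a m<j) (stirT1-above a (ℕₚ.m<n⇒m<1+n m<j)) ⟩
    + 0 - a m * + 0  ≡⟨ cong (λ x → + 0 - x) (*-zeroʳ (a m)) ⟩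
    + 0              ∎

  shift : (ℕ → ℤ) → ℕ → ℤ
  shift f zero    = + 0
  shift f (suc j) = f j

  record StirlingTriangle (c : ℕ → ℤ) (D : ℕ → ℕ → ℤ) : Set where
    field
      apex       : D 0 0 ≡ + 1
      top-row    : ∀ j → D 0 (suc j) ≡ + 0
      recurrence : ∀ k j → D (suc k) j ≡ shift (D k) j + c j * D k j

  module StirlingTriangleProperties {c : ℕ → ℤ} {D : ℕ → ℕ → ℤ} (triangle : StirlingTriangle c D) where

    open StirlingTriangle triangle

    above-diagonal : ∀ {k j} → k < j → D k j ≡ + 0
    above-diagonal {zero}  {suc j} _           = top-row j
    above-diagonal {suc k} {suc j} (s≤s k<j) = begin
      D (suc k) (suc j)                ≡⟨ recurrence k (suc j) ⟩
      D k j + c (suc j) * D k (suc j)  ≡⟨ cong₂ (λ x y → x + c (suc j) * y) (above-diagonal k<j) (above-diagonal (ℕₚ.m<n⇒m<1+n k<j)) ⟩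
      + 0 + c (suc j) * + 0            ≡⟨ cong (_+_ (+ 0)) (*-zeroʳ (c (suc j))) ⟩
      + 0                              ∎

    diagonal : ∀ k → D k k ≡ + 1
    diagonal zero    = apex
    diagonal (suc k) = begin
      D (suc k) (suc k)                ≡⟨ recurrence k (suc k) ⟩
      D k k + c (suc k) * D k (suc k)  ≡⟨ cong₂ (λ x y → x + c (suc k) * y) (diagonal k) (above-diagonal (ℕₚ.n<1+n k)) ⟩
      + 1 + c (suc k) * + 0            ≡⟨ cong (_+_ (+ 1)) (*-zeroʳ (c (suc k))) ⟩
      + 1                              ∎

    signedTransform-suc : ∀ k (g : ℕ → ℤ) →
      signedTransform D g (suc k) ≡ signedTransform D (λ j → g (suc j) - c j * g j) k
    signedTransform-suc k g = begin
      sum0 (suc k) (λ j → sgn (suc k ℕ.+ j) * D (suc k) j * g j)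
        ≡⟨ sumFrom-cong 0 (suc (suc k)) (λ j → cong (λ d → sgn (suc k ℕ.+ j) * d * g j) (recurrence k j)) ⟩
      sum0 (suc k) (λ j → sgn (suc k ℕ.+ j) * (shift (D k) j + c j * D k j) * g j)
        ≡⟨ sumFrom-cong 0 (suc (suc k)) (λ j → distrib (sgn (suc k ℕ.+ j)) (shift (D k) j) (c j * D k j) (g j)) ⟩
      sum0 (suc k) (λ j → P j + Q j)
        ≡⟨ sumFrom-+ 0 (suc (suc k)) P Q ⟩
      sum0 (suc k) P + sum0 (suc k) Q
        ≡⟨ cong₂ _+_ (sum0-head k P (cong (_* g 0) (*-zeroʳ (sgn (suc k ℕ.+ 0))))) (sum0-last k Q Q-last) ⟩
      sum0 k (P ∘ suc) + sum0 k Q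
        ≡⟨ sym (sumFrom-+ 0 (suc k) (P ∘ suc) Q) ⟩
      sum0 k (λ j → P (suc j) + Q j)
        ≡⟨ sumFrom-cong 0 (suc k) combine ⟩
      signedTransform D (λ j → g (suc j) - c j * g j) k ∎
      where
      P Q : ℕ → ℤ
      P j = sgn (suc k ℕ.+ j) * shift (D k) j * g j
      Q j = sgn (suc k ℕ.+ j) * (c j * D k j) * g j
      distrib : ∀ s x y z → s * (x + y) * z ≡ s * x * z + s * y * z
      distrib = solve-∀
      Q-last : Q (suc k) ≡ + 0
      Q-last = begin
        sgn (suc k ℕ.+ suc k) * (c (suc k) * D k (suc k)) * g (suc k)
          ≡⟨ cong (λ d → sgn (suc k ℕ.+ suc k) * (c (suc k) * d) * g (suc k)) (above-diagonal (ℕₚ.n<1+n k)) ⟩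
        sgn (suc k ℕ.+ suc k) * (c (suc k) * + 0) * g (suc k)
          ≡⟨ cong (λ x → sgn (suc k ℕ.+ suc k) * x * g (suc k)) (*-zeroʳ (c (suc k))) ⟩
        sgn (suc k ℕ.+ suc k) * + 0 * g (suc k)
          ≡⟨ cong (_* g (suc k)) (*-zeroʳ (sgn (suc k ℕ.+ suc k))) ⟩
        + 0 ∎
      combine : ∀ j → P (suc j) + Q j ≡ sgn (k ℕ.+ j) * D k j * (g (suc j) - c j * g j)
      combine j = trans (cong (λ s → s * D k j * g (suc j) + Q j) (sgn-suc-+-suc k j))
                        (factor (sgn (k ℕ.+ j)) (D k j) (g (suc j)) (c j) (g j))
        where
        factor : ∀ s d x w y → s * d * x + (- s) * (w * d) * y ≡ s * d * (x - w * y)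
        factor = solve-∀

  stirT2-triangle : ∀ (b : ℕ → ℤ) → b 0 ≡ + 0 → StirlingTriangle b (stirT2 b)
  stirT2-triangle b b₀≡0 = record
    { apex       = refl
    ; top-row    = λ _ → refl
    ; recurrence = recurrence
    }
    where
    recurrence : ∀ k j → stirT2 b (suc k) j ≡ shift (stirT2 b k) j + b j * stirT2 b k j
    recurrence k zero    = sym (cong (λ x → + 0 + x * stirT2 b k 0) b₀≡0)
    recurrence k (suc j) = refl

  centralWeight : ℕ → ℤ
  centralWeight j = (+ 1 + + j) * (+ 1 + + j)

  -- centralFactorial k j is the central factorial number T(2k+2, 2j+2).
  centralFactorial : ℕ → ℕ → ℤ
  centralFactorial zero    zero    = + 1
  centralFactorial zero    (suc j) = + 0
  centralFactorial (suc k) j       = shift (centralFactorial k) j + centralWeight j * centralFactorial k j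

  centralFactorial-triangle : StirlingTriangle centralWeight centralFactorial
  centralFactorial-triangle = record
    { apex       = refl
    ; top-row    = λ _ → refl
    ; recurrence = λ _ _ → refl
    }

  module Central = StirlingTriangleProperties centralFactorial-triangle

  signedTransform-central-squares : ∀ k → signedTransform centralFactorial (λ j → fact j * fact j) k ≡ delta₀ k
  signedTransform-central-squares zero    = refl
  signedTransform-central-squares (suc k) =
    trans (Central.signedTransform-suc k _) (sumFrom-zero 0 (suc k) _ (λ j _ _ → telescopes j))
    where
    telescopes : ∀ j → sgn (k ℕ.+ j) * centralFactorial k j
                         * (fact (suc j) * fact (suc j) - centralWeight j * (fact j * fact j)) ≡ + 0
    telescopes j =
      trans (cong (λ f → sgn (k ℕ.+ j) * centralFactorial k j * (f * f - centralWeight j * (fact j * fact j))) (fact-suc j))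
            (vanish (sgn (k ℕ.+ j)) (centralFactorial k j) (+ j) (fact j))
      where
      vanish : ∀ s d J f → s * d * ((+ 1 + J) * f * ((+ 1 + J) * f) - (+ 1 + J) * (+ 1 + J) * (f * f)) ≡ + 0
      vanish = solve-∀

  Recurrent : (ℕ → ℤ) → (ℕ → ℕ → ℤ) → Set
  Recurrent a F = ∀ m n → F (suc m) n ≡ F m (suc n) + a m * F m n

  recurrent-unique : ∀ {a} {F G : ℕ → ℕ → ℤ} → Recurrent a F → Recurrent a G →
                     (∀ m → F m 0 ≡ G m 0) → ∀ m n → F m n ≡ G m n
  recurrent-unique {a} {F} {G} recF recG F≡G₀ = agree
    where
    agree : ∀ m n → F m n ≡ G m n
    agree m zero    = F≡G₀ m
    agree m (suc n) = begin
      F m (suc n)                ≡⟨ isolateˡ (recF m n) ⟩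
      F (suc m) n - a m * F m n  ≡⟨ cong₂ (λ x y → x - a m * y) (agree (suc m) n) (agree m n) ⟩
      G (suc m) n - a m * G m n  ≡⟨ sym (isolateˡ (recG m n)) ⟩
      G m (suc n)                ∎

  stirling₁Table : (ℕ → ℤ) → (ℕ → ℤ) → ℕ → ℕ → ℤ
  stirling₁Table a h m n = signedTransform (stirT1 a) (λ j → h (n ℕ.+ j)) m

  stirling₁Table-recurrent : ∀ (a h : ℕ → ℤ) → a 0 ≡ + 0 → Recurrent a (stirling₁Table a h)
  stirling₁Table-recurrent a h a₀≡0 m n = begin
    sum0 (suc m) (G (suc m) n)
      ≡⟨ sum0-head m (G (suc m) n) (first-column m n) ⟩
    sum0 m (λ j → G (suc m) n (suc j))
      ≡⟨ sumFrom-cong 0 (suc m) split ⟩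
    sum0 m (λ j → G m (suc n) j + a m * G m n (suc j))
      ≡⟨ sumFrom-+ 0 (suc m) (G m (suc n)) _ ⟩
    sum0 m (G m (suc n)) + sum0 m (λ j → a m * G m n (suc j))
      ≡⟨ cong (_+_ (sum0 m (G m (suc n)))) (sum0-shift m (λ j → a m * G m n j) (a*first-column m) a*last-column) ⟩
    sum0 m (G m (suc n)) + sum0 m (λ j → a m * G m n j)
      ≡⟨ cong (_+_ (sum0 m (G m (suc n)))) (sym (*-sumFrom 0 (suc m) (a m) (G m n))) ⟩
    sum0 m (G m (suc n)) + a m * sum0 m (G m n) ∎
    where
    G : ℕ → ℕ → ℕ → ℤ
    G m n j = sgn (m ℕ.+ j) * stirT1 a m j * h (n ℕ.+ j)
    first-column : ∀ m n → G (suc m) n 0 ≡ + 0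
    first-column m n = cong (_* h (n ℕ.+ 0)) (*-zeroʳ (sgn (suc m ℕ.+ 0)))
    a*first-column : ∀ m → a m * G m n 0 ≡ + 0
    a*first-column zero    = cong (_* G 0 n 0) a₀≡0
    a*first-column (suc k) = trans (cong (a (suc k) *_) (first-column k n)) (*-zeroʳ (a (suc k)))
    a*last-column : a m * G m n (suc m) ≡ + 0
    a*last-column = begin
      a m * (sgn (m ℕ.+ suc m) * stirT1 a m (suc m) * h (n ℕ.+ suc m))
        ≡⟨ cong (λ t → a m * (sgn (m ℕ.+ suc m) * t * h (n ℕ.+ suc m))) (stirT1-above a (ℕₚ.n<1+n m)) ⟩
      a m * (sgn (m ℕ.+ suc m) * + 0 * h (n ℕ.+ suc m))
        ≡⟨ cong (λ x → a m * (x * h (n ℕ.+ suc m))) (*-zeroʳ (sgn (m ℕ.+ suc m))) ⟩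
      a m * + 0
        ≡⟨ *-zeroʳ (a m) ⟩
      + 0 ∎
    split : ∀ j → G (suc m) n (suc j) ≡ G m (suc n) j + a m * G m n (suc j)
    split j = begin
      sgn (suc m ℕ.+ suc j) * (t j - a m * t (suc j)) * h (n ℕ.+ suc j)
        ≡⟨ cong₂ (λ s i → s * (t j - a m * t (suc j)) * h i) (sgn-suc-+-suc m j) (ℕₚ.+-suc n j) ⟩
      sgn (m ℕ.+ j) * (t j - a m * t (suc j)) * h (suc n ℕ.+ j)
        ≡⟨ expand (sgn (m ℕ.+ j)) (t j) (a m) (t (suc j)) (h (suc n ℕ.+ j)) ⟩
      sgn (m ℕ.+ j) * t j * h (suc n ℕ.+ j) + a m * (- sgn (m ℕ.+ j) * t (suc j) * h (suc n ℕ.+ j))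
        ≡⟨ cong₂ (λ s i → G m (suc n) j + a m * (s * t (suc j) * h i)) (sym (sgn-+-suc m j)) (sym (ℕₚ.+-suc n j)) ⟩
      G m (suc n) j + a m * G m n (suc j) ∎
      where
      t : ℕ → ℤ
      t = stirT1 a m
      expand : ∀ s x b y z → s * (x - b * y) * z ≡ s * x * z + b * (- s * y * z)
      expand = solve-∀

  factorialKernel : ℕ → ℕ → ℤ
  factorialKernel m j = fact j * fact (j ℕ.+ m)

  factorialKernel-recurrence : ∀ m j →
    factorialKernel m (suc j) - legendreSeq j * factorialKernel m j + legendreSeq m * factorialKernel m j
      ≡ (+ 1 + + m) * factorialKernel (suc m) j
  factorialKernel-recurrence m j = begin
    fact (suc j) * fact (suc (j ℕ.+ m)) - legendreSeq j * K + legendreSeq m * K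
      ≡⟨ cong₂ (λ x y → x * y - legendreSeq j * K + legendreSeq m * K) (fact-suc j) (fact-suc (j ℕ.+ m)) ⟩
    (+ 1 + + j) * fact j * ((+ 1 + + (j ℕ.+ m)) * fact (j ℕ.+ m)) - legendreSeq j * K + legendreSeq m * K
      ≡⟨ cong₂ (λ x y → (+ 1 + + j) * fact j * ((+ 1 + + (j ℕ.+ m)) * fact (j ℕ.+ m)) - x * K + y * K)
               (legendreSeq-≡ j) (legendreSeq-≡ m) ⟩
    (+ 1 + + j) * fact j * ((+ 1 + + (j ℕ.+ m)) * fact (j ℕ.+ m))
      - + j * (+ 1 + + j) * K + + m * (+ 1 + + m) * K
      ≡⟨ cong (λ x → (+ 1 + + j) * fact j * ((+ 1 + x) * fact (j ℕ.+ m)) - + j * (+ 1 + + j) * K + + m * (+ 1 + + m) * K)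
              (pos-+ j m) ⟩
    (+ 1 + + j) * fact j * ((+ 1 + (+ j + + m)) * fact (j ℕ.+ m))
      - + j * (+ 1 + + j) * K + + m * (+ 1 + + m) * K
      ≡⟨ identity (+ j) (+ m) (fact j) (fact (j ℕ.+ m)) ⟩
    (+ 1 + + m) * (fact j * ((+ 1 + (+ j + + m)) * fact (j ℕ.+ m)))
      ≡⟨ cong (λ x → (+ 1 + + m) * (fact j * ((+ 1 + x) * fact (j ℕ.+ m)))) (sym (pos-+ j m)) ⟩
    (+ 1 + + m) * (fact j * ((+ 1 + + (j ℕ.+ m)) * fact (j ℕ.+ m)))
      ≡⟨ cong (λ x → (+ 1 + + m) * (fact j * x)) (sym (fact-suc (j ℕ.+ m))) ⟩
    (+ 1 + + m) * (fact j * fact (suc (j ℕ.+ m)))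
      ≡⟨ cong (λ i → (+ 1 + + m) * (fact j * fact i)) (sym (ℕₚ.+-suc j m)) ⟩
    (+ 1 + + m) * factorialKernel (suc m) j ∎
    where
    K : ℤ
    K = factorialKernel m j
    identity : ∀ J M f g →
      (+ 1 + J) * f * ((+ 1 + (J + M)) * g) - J * (+ 1 + J) * (f * g) + M * (+ 1 + M) * (f * g)
        ≡ (+ 1 + M) * (f * ((+ 1 + (J + M)) * g))
    identity = solve-∀

  factorialTable : ℕ → ℕ → ℤ
  factorialTable m n = fact m * signedTransform LS (factorialKernel m) n

  module Legendre = StirlingTriangleProperties (stirT2-triangle legendreSeq refl)

  factorialTable-recurrent : Recurrent legendreSeq factorialTable
  factorialTable-recurrent m n = sym (begin
    fact m * T (factorialKernel m) (suc n) + a m * (fact m * T (factorialKernel m) n)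
      ≡⟨ cong (λ x → fact m * x + a m * (fact m * T (factorialKernel m) n)) (Legendre.signedTransform-suc n _) ⟩
    fact m * T (λ j → factorialKernel m (suc j) - a j * factorialKernel m j) n + a m * (fact m * T (factorialKernel m) n)
      ≡⟨ regroup (fact m) (a m) _ _ ⟩
    fact m * (T (λ j → factorialKernel m (suc j) - a j * factorialKernel m j) n + a m * T (factorialKernel m) n)
      ≡⟨ cong (λ x → fact m * (T (λ j → factorialKernel m (suc j) - a j * factorialKernel m j) n + x))
              (signedTransform-* LS (a m) _ n) ⟩
    fact m * (T (λ j → factorialKernel m (suc j) - a j * factorialKernel m j) n + T (λ j → a m * factorialKernel m j) n)
      ≡⟨ cong (fact m *_) (sym (signedTransform-+ LS _ _ n)) ⟩
    fact m * T (λ j → factorialKernel m (suc j) - a j * factorialKernel m j + a m * factorialKernel m j) n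
      ≡⟨ cong (fact m *_) (signedTransform-cong LS n (factorialKernel-recurrence m)) ⟩
    fact m * T (λ j → (+ 1 + + m) * factorialKernel (suc m) j) n
      ≡⟨ cong (fact m *_) (sym (signedTransform-* LS (+ 1 + + m) _ n)) ⟩
    fact m * ((+ 1 + + m) * T (factorialKernel (suc m)) n)
      ≡⟨ reassoc (fact m) (+ 1 + + m) _ ⟩
    (+ 1 + + m) * fact m * T (factorialKernel (suc m)) n
      ≡⟨ cong (_* T (factorialKernel (suc m)) n) (sym (fact-suc m)) ⟩
    fact (suc m) * T (factorialKernel (suc m)) n ∎)
    where
    a : ℕ → ℤ
    a = legendreSeq
    T : (ℕ → ℤ) → ℕ → ℤ
    T = signedTransform LS
    regroup : ∀ f x u v → f * u + x * (f * v) ≡ f * (u + x * v)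
    regroup = solve-∀
    reassoc : ∀ f x u → f * (x * u) ≡ x * f * u
    reassoc = solve-∀

  module CentralFactorialExpansion
    (F V U : ℕ → ℕ → ℤ)
    (F-recurrent : Recurrent legendreSeq F)
    (V-zero : ∀ n → V 0 n ≡ F 0 n)
    (U-zero : ∀ n → U 0 n ≡ + 0)
    (V-step : ∀ k n → V k (suc n) ≡ U (suc k) n + V (suc k) n)
    (U-step : ∀ k n → U (suc k) n ≡ U k (suc n) + V k n)
    where

    T : (ℕ → ℤ) → ℕ → ℤ
    T = signedTransform centralFactorial

    weighted : ℕ → ℕ → ℤ
    weighted n j = (+ 1 + + j) * F j n

    F-step : ∀ j n → F (suc j) n ≡ F j (suc n) + + j * (+ 1 + + j) * F j n
    F-step j n = trans (F-recurrent j n) (cong (λ x → F j (suc n) + x * F j n) (legendreSeq-≡ j))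

    mutual
      V-expansion : ∀ k n → V k n ≡ T (λ j → F j n) k
      V-expansion zero    n = trans (V-zero n) (sym (signedTransform-zero centralFactorial (λ j → F j n) refl))
      V-expansion (suc k) n = trans (V-suc-expansion k n) (sym (Central.signedTransform-suc k (λ j → F j n)))

      U-expansion : ∀ k n → U (suc k) n ≡ T (weighted n) k
      U-expansion zero    n = begin
        U 1 n                    ≡⟨ U-step 0 n ⟩
        U 0 (suc n) + V 0 n      ≡⟨ cong₂ _+_ (U-zero (suc n)) (V-zero n) ⟩
        + 0 + F 0 n              ≡⟨ +-identityˡ (F 0 n) ⟩
        F 0 n                    ≡⟨ sym (*-identityˡ (F 0 n)) ⟩
        weighted n 0             ≡⟨ sym (signedTransform-zero centralFactorial (weighted n) refl) ⟩
        T (weighted n) 0         ∎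
      U-expansion (suc k) n = begin
        U (suc (suc k)) n
          ≡⟨ U-step (suc k) n ⟩
        U (suc k) (suc n) + V (suc k) n
          ≡⟨ cong₂ _+_ (U-expansion k (suc n)) (V-suc-expansion k n) ⟩
        T (weighted (suc n)) k + T (λ j → F (suc j) n - centralWeight j * F j n) k
          ≡⟨ sym (signedTransform-+ centralFactorial _ _ k) ⟩
        T (λ j → weighted (suc n) j + (F (suc j) n - centralWeight j * F j n)) k
          ≡⟨ signedTransform-cong centralFactorial k pointwise ⟩
        T (λ j → weighted n (suc j) - centralWeight j * weighted n j) k
          ≡⟨ sym (Central.signedTransform-suc k (weighted n)) ⟩
        T (weighted n) (suc k) ∎
        where
        pointwise : ∀ j → weighted (suc n) j + (F (suc j) n - centralWeight j * F j n)
                            ≡ weighted n (suc j) - centralWeight j * weighted n j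
        pointwise j = begin
          (+ 1 + + j) * F j (suc n) + (F (suc j) n - centralWeight j * F j n)
            ≡⟨ cong (λ x → (+ 1 + + j) * F j (suc n) + (x - centralWeight j * F j n)) (F-step j n) ⟩
          (+ 1 + + j) * F j (suc n) + (F j (suc n) + + j * (+ 1 + + j) * F j n - centralWeight j * F j n)
            ≡⟨ identity (+ j) (F j (suc n)) (F j n) ⟩
          (+ 1 + (+ 1 + + j)) * (F j (suc n) + + j * (+ 1 + + j) * F j n) - centralWeight j * weighted n j
            ≡⟨ cong (λ x → (+ 1 + (+ 1 + + j)) * x - centralWeight j * weighted n j) (sym (F-step j n)) ⟩
          weighted n (suc j) - centralWeight j * weighted n j ∎
          where
          identity : ∀ J x y →
            (+ 1 + J) * x + (x + J * (+ 1 + J) * y - (+ 1 + J) * (+ 1 + J) * y)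
              ≡ (+ 1 + (+ 1 + J)) * (x + J * (+ 1 + J) * y) - (+ 1 + J) * (+ 1 + J) * ((+ 1 + J) * y)
          identity = solve-∀

      V-suc-expansion : ∀ k n → V (suc k) n ≡ T (λ j → F (suc j) n - centralWeight j * F j n) k
      V-suc-expansion k n = begin
        V (suc k) n
          ≡⟨ isolateˡ (trans (V-step k n) (+-comm (U (suc k) n) _)) ⟩
        V k (suc n) - U (suc k) n
          ≡⟨ cong₂ _-_ (V-expansion k (suc n)) (U-expansion k n) ⟩
        T (λ j → F j (suc n)) k - T (weighted n) k
          ≡⟨ signedTransform-- centralFactorial _ _ k ⟩
        T (λ j → F j (suc n) - weighted n j) k
          ≡⟨ signedTransform-cong centralFactorial k pointwise ⟩
        T (λ j → F (suc j) n - centralWeight j * F j n) k ∎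
        where
        pointwise : ∀ j → F j (suc n) - weighted n j ≡ F (suc j) n - centralWeight j * F j n
        pointwise j = begin
          F j (suc n) - (+ 1 + + j) * F j n
            ≡⟨ identity (+ j) (F j (suc n)) (F j n) ⟩
          F j (suc n) + + j * (+ 1 + + j) * F j n - centralWeight j * F j n
            ≡⟨ cong (_- centralWeight j * F j n) (sym (F-step j n)) ⟩
          F (suc j) n - centralWeight j * F j n ∎
          where
          identity : ∀ J x y → x - (+ 1 + J) * y ≡ x + J * (+ 1 + J) * y - (+ 1 + J) * (+ 1 + J) * y
          identity = solve-∀

  if-true : ∀ {A : Set} {b : Bool} {x y : A} → b ≡ true → (if b then x else y) ≡ x
  if-true refl = refl

  if-false : ∀ {A : Set} {b : Bool} {x y : A} → b ≡ false → (if b then x else y) ≡ y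
  if-false refl = refl

  ≤ᵇ-true : ∀ {m n} → m ≤ n → (m ≤ᵇ n) ≡ true
  ≤ᵇ-true m≤n = Equivalence.to T-≡ (ℕₚ.≤⇒≤ᵇ m≤n)

  ≤ᵇ-false : ∀ {m n} → n < m → (m ≤ᵇ n) ≡ false
  ≤ᵇ-false {m} {n} n<m with m ≤ᵇ n | ℕₚ.≤ᵇ-reflects-≤ m n
  ... | false | _       = refl
  ... | true  | ofʸ m≤n = contradiction m≤n (ℕₚ.<⇒≱ n<m)

  even-suc : ∀ k → even (suc k) ≡ not (even k)
  even-suc k with even k
  ... | true  = refl
  ... | false = refl

  double : ℕ → ℕ
  double zero    = zero
  double (suc n) = suc (suc (double n))

  2*≡double : ∀ n → 2 ℕ.* n ≡ double n
  2*≡double zero    = refl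
  2*≡double (suc n) = cong suc (trans (ℕₚ.+-suc n (n ℕ.+ 0)) (cong suc (2*≡double n)))

  n≤double : ∀ n → n ≤ double n
  n≤double zero    = z≤n
  n≤double (suc n) = s≤s (ℕₚ.m≤n⇒m≤1+n (n≤double n))

  double-mono-≤ : ∀ {m n} → m ≤ n → double m ≤ double n
  double-mono-≤ z≤n       = z≤n
  double-mono-≤ (s≤s m≤n) = s≤s (s≤s (double-mono-≤ m≤n))

  even-double : ∀ n → even (double n) ≡ true
  even-double zero    = refl
  even-double (suc n) = begin
    even (suc (suc (double n)))      ≡⟨ even-suc (suc (double n)) ⟩
    not (even (suc (double n)))      ≡⟨ cong not (even-suc (double n)) ⟩
    not (not (even (double n)))      ≡⟨ not-involutive _ ⟩
    even (double n)                  ≡⟨ even-double n ⟩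
    true                             ∎

  oddCol evenCol : ℕ → ℕ
  oddCol  N = suc (double N)
  evenCol N = suc (suc (double N))

  even-oddCol : ∀ N → even (oddCol N) ≡ false
  even-oddCol N = trans (even-suc (double N)) (cong not (even-double N))

  seidel-inside : ∀ r j → double (suc r) ≤ suc (suc (suc j)) →
    seidel (suc r) (suc (suc j))
      ≡ (if even (suc (suc j)) then sumFrom (suc r) (suc j) (λ q → seidel q (suc j))
                               else sumFrom 1 (suc r) (λ q → seidel q (suc j)))
  seidel-inside r j inside = if-true (≤ᵇ-true (subst (_≤ suc (suc (suc j))) (sym (2*≡double (suc r))) inside))

  seidel-outside : ∀ r j → suc (suc (suc j)) < double (suc r) → seidel (suc r) (suc (suc j)) ≡ + 0
  seidel-outside r j outside = if-false (≤ᵇ-false (subst (suc (suc (suc j)) <_) (sym (2*≡double (suc r))) outside))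

  seidel-evenCol-outside : ∀ N r → N < r → seidel (suc r) (evenCol N) ≡ + 0
  seidel-evenCol-outside N r N<r = seidel-outside r (double N) (s≤s (s≤s (double-mono-≤ N<r)))

  seidel-oddCol-outside : ∀ N r → N < r → seidel (suc r) (oddCol N) ≡ + 0
  seidel-oddCol-outside zero    (suc r) _   = refl
  seidel-oddCol-outside (suc N) r       N<r = seidel-outside r (suc (double N)) (s≤s (s≤s (ℕₚ.<⇒≤ (double-mono-≤ N<r))))

  seidel-evenCol : ∀ N s → seidel (suc s) (evenCol N) ≡ sumFrom (suc s) (oddCol N) (λ q → seidel q (oddCol N))
  seidel-evenCol N s with s ℕₚ.≤? N
  ... | yes s≤N = trans (seidel-inside s (double N) (s≤s (s≤s (ℕₚ.m≤n⇒m≤1+n (double-mono-≤ s≤N)))))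
                        (if-true (even-double (suc N)))
  ... | no  s≰N = trans (seidel-evenCol-outside N s N<s) (sym (sumFrom-zero (suc s) (oddCol N) _ below))
    where
    N<s : N < s
    N<s = ℕₚ.≰⇒> s≰N
    below : ∀ q → suc s ≤ q → q < suc s ℕ.+ oddCol N → seidel q (oddCol N) ≡ + 0
    below (suc q) (s≤s s≤q) _ = seidel-oddCol-outside N q (ℕₚ.<-≤-trans N<s s≤q)

  seidel-evenCol-step : ∀ N s →
    seidel (suc s) (evenCol N) ≡ seidel (suc s) (oddCol N) + seidel (suc (suc s)) (evenCol N)
  seidel-evenCol-step N s = trans (seidel-evenCol N s) (cong (_+_ (g (suc s))) (sym tail))
    where
    g : ℕ → ℤ
    g q = seidel q (oddCol N)
    tail : seidel (suc (suc s)) (evenCol N) ≡ sumFrom (suc (suc s)) (double N) g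
    tail = begin
      seidel (suc (suc s)) (evenCol N)                          ≡⟨ seidel-evenCol N (suc s) ⟩
      sumFrom (suc (suc s)) (suc (double N)) g                  ≡⟨ sumFrom-suc (suc (suc s)) (double N) g ⟩
      sumFrom (suc (suc s)) (double N) g + g (suc (suc s) ℕ.+ double N)
        ≡⟨ cong (_+_ (sumFrom (suc (suc s)) (double N) g)) (seidel-oddCol-outside N (suc s ℕ.+ double N) N<) ⟩
      sumFrom (suc (suc s)) (double N) g + + 0                  ≡⟨ +-identityʳ _ ⟩
      sumFrom (suc (suc s)) (double N) g                        ∎
      where
      N< : N < suc s ℕ.+ double N
      N< = s≤s (ℕₚ.≤-trans (n≤double N) (ℕₚ.m≤n+m (double N) s))

  seidel-oddCol : ∀ N s → s ≤ suc N → seidel (suc s) (oddCol (suc N)) ≡ sumFrom 1 (suc s) (λ q → seidel q (evenCol N))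
  seidel-oddCol N s s≤ = trans (seidel-inside s (suc (double N)) (s≤s (s≤s (double-mono-≤ s≤))))
                               (if-false (even-oddCol (suc N)))

  seidel-oddCol-step : ∀ N s → s ≤ suc N →
    seidel (suc s) (oddCol (suc N)) ≡ seidel s (oddCol (suc N)) + seidel (suc s) (evenCol N)
  seidel-oddCol-step N s s≤ = begin
    seidel (suc s) (oddCol (suc N))  ≡⟨ seidel-oddCol N s s≤ ⟩
    sumFrom 1 (suc s) g              ≡⟨ sumFrom-suc 1 s g ⟩
    sumFrom 1 s g + g (suc s)        ≡⟨ cong (_+ g (suc s)) (prefix s s≤) ⟩
    seidel s (oddCol (suc N)) + g (suc s) ∎
    where
    g : ℕ → ℤ
    g q = seidel q (evenCol N)
    prefix : ∀ s → s ≤ suc N → sumFrom 1 s g ≡ seidel s (oddCol (suc N))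
    prefix zero    _  = refl
    prefix (suc s) s< = sym (seidel-oddCol N s (ℕₚ.m≤n⇒m≤1+n (ℕₚ.≤-pred s<)))

  -- H_{2n-1}, with H_{-1} = 1.
  medianGenocchi′ : ℕ → ℤ
  medianGenocchi′ zero    = + 1
  medianGenocchi′ (suc n) = medianGenocchi (suc n)

  -- seidelV s t = g_{s+1,2(s+t)} except seidelV 0 0 = 1, and seidelU (s+1) t = g_{s+1,2(s+t)+1}.
  seidelV : ℕ → ℕ → ℤ
  seidelV zero    n = medianGenocchi′ n
  seidelV (suc s) t = seidel (suc (suc s)) (evenCol (s ℕ.+ t))

  seidelU : ℕ → ℕ → ℤ
  seidelU zero    t = + 0
  seidelU (suc s) t = seidel (suc s) (oddCol (s ℕ.+ t))

  seidelV-suc : ∀ s t → seidelV s (suc t) ≡ seidel (suc s) (evenCol (s ℕ.+ t))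
  seidelV-suc zero    t = cong (seidel 1) (2*≡double (suc t))
  seidelV-suc (suc s) t = cong (λ N → seidel (suc (suc s)) (evenCol N)) (ℕₚ.+-suc s t)

  seidelV-step : ∀ s t → seidelV s (suc t) ≡ seidelU (suc s) t + seidelV (suc s) t
  seidelV-step s t = trans (seidelV-suc s t) (seidel-evenCol-step (s ℕ.+ t) s)

  seidelU-step : ∀ s t → seidelU (suc s) t ≡ seidelU s (suc t) + seidelV s t
  seidelU-step zero    zero    = refl
  seidelU-step zero    (suc t) = trans (seidel-oddCol-step t 0 z≤n) (cong (_+_ (+ 0)) (sym (seidelV-suc 0 t)))
  seidelU-step (suc s) t       =
    trans (seidel-oddCol-step (s ℕ.+ t) (suc s) (s≤s (ℕₚ.m≤m+n s t)))
          (cong (λ N → seidel (suc s) (oddCol N) + seidelV (suc s) t) (sym (ℕₚ.+-suc s t)))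

  seidelV-first-column : ∀ k → seidelV k 0 ≡ delta₀ k
  seidelV-first-column zero    = refl
  seidelV-first-column (suc k) = seidel-evenCol-outside (k ℕ.+ 0) (suc k) (s≤s (ℕₚ.≤-reflexive (ℕₚ.+-identityʳ k)))

  genocchiTable : ℕ → ℕ → ℤ
  genocchiTable = stirling₁Table legendreSeq medianGenocchi′

  genocchiTable-recurrent : Recurrent legendreSeq genocchiTable
  genocchiTable-recurrent = stirling₁Table-recurrent legendreSeq medianGenocchi′ refl

  seidelV-zero : ∀ n → seidelV 0 n ≡ genocchiTable 0 n
  seidelV-zero n = trans (cong medianGenocchi′ (sym (ℕₚ.+-identityʳ n)))
                         (sym (signedTransform-zero (stirT1 legendreSeq) (λ j → medianGenocchi′ (n ℕ.+ j)) refl))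

  seidelU-zero : ∀ n → seidelU 0 n ≡ + 0
  seidelU-zero _ = refl

  module SeidelExpansion =
    CentralFactorialExpansion genocchiTable seidelV seidelU genocchiTable-recurrent seidelV-zero seidelU-zero seidelV-step seidelU-step

  genocchiTable-first-column : ∀ k → genocchiTable k 0 ≡ fact k * fact k
  genocchiTable-first-column = signedTransform-injective centralFactorial Central.diagonal transforms-agree
    where
    transforms-agree : ∀ k → signedTransform centralFactorial (λ j → genocchiTable j 0) k
                               ≡ signedTransform centralFactorial (λ j → fact j * fact j) k
    transforms-agree k = begin
      signedTransform centralFactorial (λ j → genocchiTable j 0) k  ≡⟨ sym (SeidelExpansion.V-expansion k 0) ⟩
      seidelV k 0                                                    ≡⟨ seidelV-first-column k ⟩
      delta₀ k                                                       ≡⟨ sym (signedTransform-central-squares k) ⟩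
      signedTransform centralFactorial (λ j → fact j * fact j) k    ∎

  factorialTable-first-column : ∀ m → factorialTable m 0 ≡ fact m * fact m
  factorialTable-first-column m =
    cong (fact m *_) (trans (signedTransform-zero LS (factorialKernel m) refl) (*-identityˡ (fact m)))

  genocchiTable≡factorialTable : ∀ m n → genocchiTable m n ≡ factorialTable m n
  genocchiTable≡factorialTable =
    recurrent-unique {legendreSeq} genocchiTable-recurrent factorialTable-recurrent
      (λ m → trans (genocchiTable-first-column m) (sym (factorialTable-first-column m)))

  factorialTable-reassoc : ∀ m n →
    factorialTable m n ≡ fact m * sum0 n (λ j → sgn (n ℕ.+ j) * LS n j * fact j * fact (j ℕ.+ m))
  factorialTable-reassoc m n =
    cong (fact m *_) (sumFrom-cong 0 (suc n) (λ j → sym (*-assoc (sgn (n ℕ.+ j) * LS n j) (fact j) (fact (j ℕ.+ m)))))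

open LegendreGenocchi using (genocchiTable≡factorialTable; factorialTable-reassoc)
open import Data.Nat using (ℕ; suc; _+_)

proposition5 : (m n : ℕ) →
    sum0 m (λ j → sgn (m + j) * Ls m j * medianGenocchi (suc n + j))
      ≡ fact m * sum0 (suc n) (λ j → sgn (suc n + j) * LS (suc n) j * fact j * fact (j + m))
proposition5 m n = trans (genocchiTable≡factorialTable m (suc n)) (factorialTable-reassoc m (suc n))
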